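{- Let $n,m,k,\ell,c$ be positive integers with $n\le k$ and $n<m<k+\ell$, and consider the equation $x^n+y^m=c\,x^k y^\ell$ in positive integers $x,y$. If $c\neq 2$, the equation has no solution in positive integers. If $c=2$, the equation has the unique solution $(x,y)=(1,1)$.
   Context: A solution means an ordered pair $(x,y)$ of positive integers satisfying the equation. -}

module Defs where

open import Data.Nat using (ℕ; _+_; _*_; _^_; _<_)
open import Data.Product using (_×_)
open import Relation.Binary.PropositionalEquality using (_≡_)

Solution : (n m k ℓ c x y : ℕ) → Set
Solution n m k ℓ c x y = 0 < x × 0 < y × (x ^ n + y ^ m ≡ c * x ^ k * y ^ ℓ)

{-# OPTIONS --safe #-}
module Submission where

-- Put a = xⁿ, k = n + j and ℓ = 1 + ℓ′. The equation reads a + yᵐ = a · y · s with s = c xʲ y^ℓ′,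
-- so a ∣ yᵐ; writing yᵐ = q a gives 1 + q = y s, so y is coprime to q and hence yᵐ ∣ a. Thus
-- yᵐ = a, q = 1 and y s = 2. If s = 1 then xʲ = y^ℓ′ = 1, and n < m < k + ℓ makes j or ℓ′
-- positive, so again y = 1 (when j > 0 through x = 1 and yᵐ = xⁿ). Then x = 1 and c = s = 2.

open import Defs
open import Data.Nat using (ℕ; zero; suc; _+_; _*_; _^_; _<_; _≤_; NonZero; >-nonZero; z<s; s≤s)
open import Data.Nat.Properties
open import Data.Nat.Divisibility
open import Data.Nat.Coprimality using (Coprime; coprime-divisor)
open import Data.Nat.Solver using (module +-*-Solver)
open import Data.Product using (_×_; _,_; proj₁; proj₂)
open import Data.Sum using (_⊎_; inj₁; inj₂; [_,_]′)
open import Data.Empty using (⊥-elim)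
open import Relation.Binary.PropositionalEquality
open import Relation.Nullary using (¬_)
open import Function using (id)
open +-*-Solver using (solve; _:*_; _:=_)

coprime-^ˡ : ∀ {m n} k → Coprime m n → Coprime (m ^ k) n
coprime-^ˡ zero    _   (i∣1 , _)            = ∣1⇒≡1 i∣1
coprime-^ˡ (suc k) m⊥n {i} (i∣m*mᵏ , i∣n) = coprime-^ˡ k m⊥n (coprime-divisor i⊥m i∣m*mᵏ , i∣n)
  where
  i⊥m : Coprime i _
  i⊥m (d∣i , d∣m) = m⊥n (d∣m , ∣-trans d∣i i∣n)

∣suc⇒coprime : ∀ {d q} → d ∣ suc q → Coprime d q
∣suc⇒coprime {q = q} d∣1+q {i} (i∣d , i∣q) =
  ∣1⇒≡1 (∣m+n∣m⇒∣n (subst (i ∣_) (+-comm 1 q) (∣-trans i∣d d∣1+q)) i∣q)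

m^n≡1⇒m≡1 : ∀ {m n} → 0 < n → m ^ n ≡ 1 → m ≡ 1
m^n≡1⇒m≡1 {m} {suc n} _ = m*n≡1⇒m≡1 m (m ^ n)

m*n≡2⇒m≡1⊎n≡1 : ∀ m n → m * n ≡ 2 → m ≡ 1 ⊎ n ≡ 1
m*n≡2⇒m≡1⊎n≡1 0                   n ()
m*n≡2⇒m≡1⊎n≡1 1                   n _  = inj₁ refl
m*n≡2⇒m≡1⊎n≡1 2                   n eq = inj₂ (*-cancelˡ-≡ n 1 2 eq)
m*n≡2⇒m≡1⊎n≡1 (suc (suc (suc m))) n eq
  with ∣⇒≤ {2} (divides n (trans (sym eq) (*-comm (3 + m) n)))
... | s≤s (s≤s ())

a+yᵐ≡a*[y*s]⇒a≡yᵐ×y*s≡2 : ∀ a y m s .{{_ : NonZero a}} →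
                           a + y ^ m ≡ a * (y * s) → a ≡ y ^ m × y * s ≡ 2
a+yᵐ≡a*[y*s]⇒a≡yᵐ×y*s≡2 a y m s eq = a≡yᵐ , trans (sym 1+q≡y*s) (cong suc q≡1)
  where
  a∣yᵐ : a ∣ y ^ m
  a∣yᵐ = ∣m+n∣m⇒∣n (subst (a ∣_) (sym eq) (m∣m*n (y * s))) ∣-refl
  q : ℕ
  q = quotient a∣yᵐ
  yᵐ≡q*a : y ^ m ≡ q * a
  yᵐ≡q*a = _∣_.equality a∣yᵐ
  1+q≡y*s : suc q ≡ y * s
  1+q≡y*s = *-cancelˡ-≡ (suc q) (y * s) a (begin
    a * suc q   ≡⟨ *-suc a q ⟩
    a + a * q   ≡⟨ cong (a +_) (trans (*-comm a q) (sym yᵐ≡q*a)) ⟩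
    a + y ^ m   ≡⟨ eq ⟩
    a * (y * s) ∎)
    where open ≡-Reasoning
  yᵐ∣a : y ^ m ∣ a
  yᵐ∣a = coprime-divisor (coprime-^ˡ m (∣suc⇒coprime (subst (y ∣_) (sym 1+q≡y*s) (m∣m*n s))))
                         (subst (y ^ m ∣_) yᵐ≡q*a ∣-refl)
  a≡yᵐ : a ≡ y ^ m
  a≡yᵐ = ∣-antisym a∣yᵐ yᵐ∣a
  q≡1 : q ≡ 1
  q≡1 = *-cancelʳ-≡ q 1 a (trans (sym yᵐ≡q*a) (trans (sym a≡yᵐ) (sym (*-identityˡ a))))

0<j⊎0<ℓ : ∀ {n m} j ℓ → n < m → m < n + j + suc ℓ → 0 < j ⊎ 0 < ℓ
0<j⊎0<ℓ         (suc j) ℓ       _   _     = inj₁ z<s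
0<j⊎0<ℓ         zero    (suc ℓ) _   _     = inj₂ z<s
0<j⊎0<ℓ {n} {m} zero    zero    n<m m<n+1 =
  ⊥-elim (<⇒≱ n<m (m<1+n⇒m≤n (subst (m <_) n+0+1≡1+n m<n+1)))
  where
  n+0+1≡1+n : n + 0 + 1 ≡ suc n
  n+0+1≡1+n = trans (cong (_+ 1) (+-identityʳ n)) (+-comm n 1)

solution⇒x≡1×y≡1×c≡2′ : ∀ {n m j ℓ c x y} → 0 < n → n < m → m < n + j + suc ℓ →
                        Solution n m (n + j) (suc ℓ) c x y → x ≡ 1 × y ≡ 1 × c ≡ 2
solution⇒x≡1×y≡1×c≡2′ {n} {m} {j} {ℓ} {c} {x} {y} 0<n n<m m<n+j+1+ℓ (0<x , _ , eq) =
  x≡1 , y≡1 , c≡2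
  where
  open ≡-Reasoning
  instance
    xⁿ≢0 : NonZero (x ^ n)
    xⁿ≢0 = m^n≢0 x n {{>-nonZero 0<x}}
  s : ℕ
  s = c * x ^ j * y ^ ℓ
  factored : x ^ n + y ^ m ≡ x ^ n * (y * s)
  factored = begin
    x ^ n + y ^ m                     ≡⟨ eq ⟩
    c * x ^ (n + j) * (y * y ^ ℓ)     ≡⟨ cong (λ t → c * t * (y * y ^ ℓ)) (^-distribˡ-+-* x n j) ⟩
    c * (x ^ n * x ^ j) * (y * y ^ ℓ) ≡⟨ solve 5 (λ c a b y z → c :* (a :* b) :* (y :* z) := a :* (y :* (c :* b :* z)))
                                               refl c (x ^ n) (x ^ j) y (y ^ ℓ) ⟩
    x ^ n * (y * s)                   ∎
  xⁿ≡yᵐ : x ^ n ≡ y ^ m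
  xⁿ≡yᵐ = proj₁ (a+yᵐ≡a*[y*s]⇒a≡yᵐ×y*s≡2 (x ^ n) y m s factored)
  y*s≡2 : y * s ≡ 2
  y*s≡2 = proj₂ (a+yᵐ≡a*[y*s]⇒a≡yᵐ×y*s≡2 (x ^ n) y m s factored)
  s≡1⇒y≡1 : s ≡ 1 → y ≡ 1
  s≡1⇒y≡1 s≡1 = [ via-x , via-yˡ ]′ (0<j⊎0<ℓ j ℓ n<m m<n+j+1+ℓ)
    where
    xʲ≡1 : x ^ j ≡ 1
    xʲ≡1 = m*n≡1⇒n≡1 c (x ^ j) (m*n≡1⇒m≡1 (c * x ^ j) (y ^ ℓ) s≡1)
    via-x : 0 < j → y ≡ 1
    via-x 0<j = m^n≡1⇒m≡1 (<-trans 0<n n<m) (begin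
      y ^ m ≡⟨ xⁿ≡yᵐ ⟨
      x ^ n ≡⟨ cong (_^ n) (m^n≡1⇒m≡1 0<j xʲ≡1) ⟩
      1 ^ n ≡⟨ ^-zeroˡ n ⟩
      1     ∎)
    via-yˡ : 0 < ℓ → y ≡ 1
    via-yˡ 0<ℓ = m^n≡1⇒m≡1 0<ℓ (m*n≡1⇒n≡1 (c * x ^ j) (y ^ ℓ) s≡1)
  y≡1 : y ≡ 1
  y≡1 = [ id , s≡1⇒y≡1 ]′ (m*n≡2⇒m≡1⊎n≡1 y s y*s≡2)
  x≡1 : x ≡ 1
  x≡1 = m^n≡1⇒m≡1 0<n (trans xⁿ≡yᵐ (trans (cong (_^ m) y≡1) (^-zeroˡ m)))
  c≡2 : c ≡ 2
  c≡2 = begin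
    c                 ≡⟨ *-identityʳ c ⟨
    c * 1             ≡⟨ *-identityʳ (c * 1) ⟨
    c * 1 * 1         ≡⟨ cong₂ (λ a b → c * a * b) (^-zeroˡ j) (^-zeroˡ ℓ) ⟨
    c * 1 ^ j * 1 ^ ℓ ≡⟨ cong₂ (λ a b → c * a ^ j * b ^ ℓ) x≡1 y≡1 ⟨
    s                 ≡⟨ *-identityˡ s ⟨
    1 * s             ≡⟨ cong (_* s) y≡1 ⟨
    y * s             ≡⟨ y*s≡2 ⟩
    2                 ∎

solution⇒x≡1×y≡1×c≡2 : ∀ {n m k ℓ c x y} → 0 < n → n < m → n ≤ k → 0 < ℓ → m < k + ℓ →
                       Solution n m k ℓ c x y → x ≡ 1 × y ≡ 1 × c ≡ 2
solution⇒x≡1×y≡1×c≡2 {ℓ = suc ℓ} 0<n n<m n≤k _ m<k+ℓ sol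
  with j , refl ← m≤n⇒∃[o]m+o≡n n≤k = solution⇒x≡1×y≡1×c≡2′ 0<n n<m m<k+ℓ sol

solution-1-1 : ∀ {n m k ℓ c} → c ≡ 2 → Solution n m k ℓ c 1 1
solution-1-1 {n} {m} {k} {ℓ} refl = z<s , z<s , (begin
  1 ^ n + 1 ^ m     ≡⟨ cong₂ _+_ (^-zeroˡ n) (^-zeroˡ m) ⟩
  2                 ≡⟨ cong₂ (λ a b → 2 * a * b) (^-zeroˡ k) (^-zeroˡ ℓ) ⟨
  2 * 1 ^ k * 1 ^ ℓ ∎)
  where open ≡-Reasoning

theorem2 : (n m k ℓ c : ℕ) → 0 < n → 0 < m → 0 < k → 0 < ℓ → 0 < c →
    n ≤ k → n < m → m < k + ℓ →
    ((¬ c ≡ 2) → (x y : ℕ) → ¬ Solution n m k ℓ c x y)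
    × (c ≡ 2 → Solution n m k ℓ c 1 1
    × ((x y : ℕ) → Solution n m k ℓ c x y → x ≡ 1 × y ≡ 1))
theorem2 n m k ℓ c 0<n _ _ 0<ℓ _ n≤k n<m m<k+ℓ =
    (λ c≢2 x y sol → c≢2 (proj₂ (proj₂ (trivial sol))))
  , λ c≡2 → solution-1-1 {n} {m} {k} {ℓ} c≡2
          , λ x y sol → proj₁ (trivial sol) , proj₁ (proj₂ (trivial sol))
  where
  trivial : ∀ {x y} → Solution n m k ℓ c x y → x ≡ 1 × y ≡ 1 × c ≡ 2
  trivial = solution⇒x≡1×y≡1×c≡2 0<n n<m n≤k 0<ℓ m<k+ℓ
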